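{- For all packed words $u,v,w$ with $w\ne\varepsilon$, $u\triangleleft_R(v\triangleleft_R w)=(u\odot v)\triangleleft_R w$.
   Context: Words over positive integers; $|w|$ length, $\max(w)$ largest letter ($\max(\varepsilon)=0$), $w^{[k]}$ adds $k$ to every letter. Packed: every integer $1..\max(w)$ occurs. $u\odot v=u^{[\max(v)]}\cdot v$. For packed $w$ of length $n$, $p\ge1$, $I=\{i_1<\dots<i_p\}\subseteq\{1..n+p\}$, $\phi_I(w)$ is the word of length $n+p$ with letter $\max(w)+1$ at positions of $I$ and the letters of $w$ in order elsewhere; each nonempty packed $v$ is uniquely $\phi_I(v')$. For packed $u$ and nonempty packed $v=\phi_I(v')$, $u\triangleleft_R v=\phi_{I+|u|}(u\odot v')$ with $I+|u|=\{i+|u|:i\in I\}$. -}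

module Defs where

open import Data.Nat using (ℕ; zero; suc; _+_; _≤_; _⊔_; _≟_)
open import Data.Bool using (Bool; true; false)
open import Data.List using (List; []; _∷_; _++_; map; foldr; filter; length; replicate)
open import Data.List.Relation.Unary.All using (All)
open import Data.List.Membership.Propositional using (_∈_)
open import Data.Product using (_×_)
open import Relation.Nullary using (¬?)
open import Relation.Nullary.Decidable using (⌊_⌋)

-- Words over positive integers are lists of naturals (positivity is part of Packed).
Word : Set
Word = List ℕ

mx : Word → ℕ
mx = foldr _⊔_ 0

shift : ℕ → Word → Word
shift k = map (k +_)

Packed : Word → Set
Packed w = All (λ x → 1 ≤ x) w × (∀ k → 1 ≤ k → k ≤ mx w → k ∈ w)

_⊙_ : Word → Word → Word
u ⊙ v = shift (mx v) u ++ v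

-- φ with an explicit letter c and the set I given by its characteristic
-- vector over positions 1..n+p (true = position in I).
-- φ_I(w) = phi (max w + 1) I w.
phi : ℕ → List Bool → Word → Word
phi c [] w = []
phi c (true ∷ m) w = c ∷ phi c m w
phi c (false ∷ m) [] = []
phi c (false ∷ m) (x ∷ w) = x ∷ phi c m w

-- Decomposition v = φ_I(v'): I = positions of the letter max(v),
-- v' = v with all occurrences of max(v) removed.
decI : Word → List Bool
decI v = map (λ x → ⌊ x ≟ mx v ⌋) v

dec' : Word → Word
dec' v = filter (λ x → ¬? (x ≟ mx v)) v

-- u ◁R v = φ_{I+|u|}(u ⊙ v'), where I+|u| has characteristic vector
-- (|u| times false) ++ I.
_◁R_ : Word → Word → Word
u ◁R v = phi (suc (mx (u ⊙ dec' v))) (replicate (length u) false ++ decI v) (u ⊙ dec' v)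

{-# OPTIONS --safe #-}
-- Write w = φ_I(w') and c = 1 + max(v ⊙ w'). Then v ◁R w is v^[max w'] · w with every occurrence of
-- max w replaced by c. As c exceeds all other letters, it is the maximum of v ◁R w, it occurs exactly
-- at the positions I + |v|, and erasing it leaves v ⊙ w'; so u ◁R (v ◁R w) = φ_{I+|v|+|u|}(u ⊙ (v ⊙ w')).
-- Associativity of ⊙ (from max(v ⊙ w) = max w + max v) and |u ⊙ v| = |u| + |v| conclude.
module Submission where

open import Defs
open import Data.List using ([])
open import Relation.Binary.PropositionalEquality using (_≡_; _≢_)

open import Data.Nat using (ℕ; zero; suc; _+_; _≤_; _<_; _⊔_; _≟_; z≤n; s≤s)
open import Data.Nat.Properties
open import Data.Bool using (Bool; true; false)
open import Data.List using (List; _∷_; _++_; map; filter; length; replicate)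
open import Data.List.Properties
  using (map-++; filter-++; filter-accept; filter-reject; length-map; length-++; ++-assoc)
open import Data.List.Relation.Unary.All using (All; []; _∷_)
open import Data.List.Relation.Unary.Any using (here; there)
open import Data.List.Membership.Propositional using (_∈_)
open import Data.Sum using (inj₁; inj₂)
open import Data.Empty using (⊥-elim)
open import Relation.Nullary using (¬?; yes; no)
open import Relation.Nullary.Decidable using (⌊_⌋)
open import Relation.Binary.PropositionalEquality
  using (refl; sym; trans; cong; cong₂; subst; module ≡-Reasoning)

open ≡-Reasoning

mx-++ : ∀ u v → mx (u ++ v) ≡ mx u ⊔ mx v
mx-++ []      v = refl
mx-++ (x ∷ u) v = trans (cong (x ⊔_) (mx-++ u v)) (sym (⊔-assoc x (mx u) (mx v)))

mx-shift-⊔ : ∀ k v → mx (shift k v) ⊔ k ≡ k + mx v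
mx-shift-⊔ k []      = sym (+-identityʳ k)
mx-shift-⊔ k (x ∷ v) = begin
  ((k + x) ⊔ mx (shift k v)) ⊔ k ≡⟨ ⊔-assoc (k + x) _ k ⟩
  (k + x) ⊔ (mx (shift k v) ⊔ k) ≡⟨ cong ((k + x) ⊔_) (mx-shift-⊔ k v) ⟩
  (k + x) ⊔ (k + mx v)           ≡⟨ sym (+-distribˡ-⊔ k x (mx v)) ⟩
  k + (x ⊔ mx v)                 ∎

mx-∷∈ : ∀ x w → mx (x ∷ w) ∈ x ∷ w
mx-∷∈ x []      = here (⊔-identityʳ x)
mx-∷∈ x (y ∷ w) with ≤-total (mx (y ∷ w)) x
... | inj₁ w≤x = here (m≥n⇒m⊔n≡m w≤x)
... | inj₂ x≤w = there (subst (_∈ y ∷ w) (sym (m≤n⇒m⊔n≡n x≤w)) (mx-∷∈ y w))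

mx∈ : ∀ {w} → w ≢ [] → mx w ∈ w
mx∈ {[]}    w≢[] = ⊥-elim (w≢[] refl)
mx∈ {x ∷ w} _    = mx-∷∈ x w

shift-shift : ∀ a b u → shift a (shift b u) ≡ shift (a + b) u
shift-shift a b []      = refl
shift-shift a b (x ∷ u) = cong₂ _∷_ (sym (+-assoc a b x)) (shift-shift a b u)

mx-⊙ : ∀ u v → mx (u ⊙ v) ≡ mx v + mx u
mx-⊙ u v = trans (mx-++ (shift (mx v) u) v) (mx-shift-⊔ (mx v) u)

length-⊙ : ∀ u v → length (u ⊙ v) ≡ length u + length v
length-⊙ u v = trans (length-++ (shift (mx v) u)) (cong (_+ length v) (length-map (mx v +_) u))

⊙-assoc : ∀ u v w → u ⊙ (v ⊙ w) ≡ (u ⊙ v) ⊙ w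
⊙-assoc u v w = begin
  shift (mx (v ⊙ w)) u ++ (shift (mx w) v ++ w)
    ≡⟨ cong (λ k → shift k u ++ (shift (mx w) v ++ w)) (mx-⊙ v w) ⟩
  shift (mx w + mx v) u ++ (shift (mx w) v ++ w)
    ≡⟨ cong (_++ (shift (mx w) v ++ w)) (sym (shift-shift (mx w) (mx v) u)) ⟩
  shift (mx w) (shift (mx v) u) ++ (shift (mx w) v ++ w)
    ≡⟨ sym (++-assoc (shift (mx w) (shift (mx v) u)) _ w) ⟩
  (shift (mx w) (shift (mx v) u) ++ shift (mx w) v) ++ w
    ≡⟨ cong (_++ w) (sym (map-++ (mx w +_) (shift (mx v) u) v)) ⟩
  shift (mx w) (shift (mx v) u ++ v) ++ w ∎

replicate-+ : ∀ {A : Set} a b (x : A) → replicate (a + b) x ≡ replicate a x ++ replicate b x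
replicate-+ zero    b x = refl
replicate-+ (suc a) b x = cong (x ∷_) (replicate-+ a b x)

phi-replicate-false-++ : ∀ c u J v → phi c (replicate (length u) false ++ J) (u ++ v) ≡ u ++ phi c J v
phi-replicate-false-++ c []      J v = refl
phi-replicate-false-++ c (x ∷ u) J v = cong (x ∷_) (phi-replicate-false-++ c u J v)

marks : ℕ → Word → List Bool
marks m = map (λ x → ⌊ x ≟ m ⌋)

erase : ℕ → Word → Word
erase m = filter (λ x → ¬? (x ≟ m))

replace : ℕ → ℕ → ℕ → ℕ
replace m c x with x ≟ m
... | yes _ = c
... | no  _ = x

⌊≟⌋-refl : ∀ x → ⌊ x ≟ x ⌋ ≡ true
⌊≟⌋-refl x with x ≟ x
... | yes _   = refl
... | no  x≢x = ⊥-elim (x≢x refl)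

⌊≟⌋-≢ : ∀ {x y} → x ≢ y → ⌊ x ≟ y ⌋ ≡ false
⌊≟⌋-≢ {x} {y} x≢y with x ≟ y
... | yes x≡y = ⊥-elim (x≢y x≡y)
... | no  _   = refl

erase-∷-reject : ∀ m w → erase m (m ∷ w) ≡ erase m w
erase-∷-reject m w = filter-reject (λ x → ¬? (x ≟ m)) (λ m≢m → m≢m refl)

erase-∷-accept : ∀ {m x} w → x ≢ m → erase m (x ∷ w) ≡ x ∷ erase m w
erase-∷-accept {m} w x≢m = filter-accept (λ x → ¬? (x ≟ m)) x≢m

phi-marks-erase : ∀ c m w → phi c (marks m w) (erase m w) ≡ map (replace m c) w
phi-marks-erase c m []      = refl
phi-marks-erase c m (x ∷ w) with x ≟ m
... | yes refl = begin
  phi c (true ∷ marks m w) (erase m (m ∷ w)) ≡⟨ cong (phi c (true ∷ marks m w)) (erase-∷-reject m w) ⟩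
  c ∷ phi c (marks m w) (erase m w)          ≡⟨ cong (c ∷_) (phi-marks-erase c m w) ⟩
  c ∷ map (replace m c) w                    ∎
... | no x≢m = begin
  phi c (false ∷ marks m w) (erase m (x ∷ w)) ≡⟨ cong (phi c (false ∷ marks m w)) (erase-∷-accept w x≢m) ⟩
  x ∷ phi c (marks m w) (erase m w)           ≡⟨ cong (x ∷_) (phi-marks-erase c m w) ⟩
  x ∷ map (replace m c) w                     ∎

marks-mx< : ∀ c u → mx u < c → marks c u ≡ replicate (length u) false
marks-mx< c []      _ = refl
marks-mx< c (x ∷ u) h =
  cong₂ _∷_ (⌊≟⌋-≢ (<⇒≢ (m⊔n<o⇒m<o x _ h))) (marks-mx< c u (m⊔n<o⇒n<o x _ h))

erase-mx< : ∀ c u → mx u < c → erase c u ≡ u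
erase-mx< c []      _ = refl
erase-mx< c (x ∷ u) h =
  trans (erase-∷-accept u (<⇒≢ (m⊔n<o⇒m<o x _ h))) (cong (x ∷_) (erase-mx< c u (m⊔n<o⇒n<o x _ h)))

module _ (m c : ℕ) where

  mx-erase<⇒bounded : ∀ w → mx (erase m w) < c → All (λ x → x ≢ m → x < c) w
  mx-erase<⇒bounded []      _ = []
  mx-erase<⇒bounded (x ∷ w) h with x ≟ m
  ... | yes refl =
    (λ m≢m → ⊥-elim (m≢m refl)) ∷ mx-erase<⇒bounded w (subst (λ e → mx e < c) (erase-∷-reject m w) h)
  ... | no  x≢m  = (λ _ → m⊔n<o⇒m<o x _ h') ∷ mx-erase<⇒bounded w (m⊔n<o⇒n<o x _ h')
    where h' = subst (λ e → mx e < c) (erase-∷-accept w x≢m) h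

  marks-replace : ∀ {w} → All (λ x → x ≢ m → x < c) w → marks c (map (replace m c) w) ≡ marks m w
  marks-replace {[]}    []       = refl
  marks-replace {x ∷ w} (hx ∷ h) with x ≟ m
  ... | yes _   = cong₂ _∷_ (⌊≟⌋-refl c) (marks-replace h)
  ... | no  x≢m = cong₂ _∷_ (⌊≟⌋-≢ (<⇒≢ (hx x≢m))) (marks-replace h)

  erase-replace : ∀ {w} → All (λ x → x ≢ m → x < c) w → erase c (map (replace m c) w) ≡ erase m w
  erase-replace {[]}    []       = refl
  erase-replace {x ∷ w} (hx ∷ h) with x ≟ m
  ... | yes refl = trans (erase-∷-reject c _) (trans (erase-replace h) (sym (erase-∷-reject m w)))
  ... | no  x≢m  = trans (erase-∷-accept _ (<⇒≢ (hx x≢m)))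
                     (trans (cong (x ∷_) (erase-replace h)) (sym (erase-∷-accept w x≢m)))

  mx-replace≤ : ∀ {w} → All (λ x → x ≢ m → x < c) w → mx (map (replace m c) w) ≤ c
  mx-replace≤ {[]}    []       = z≤n
  mx-replace≤ {x ∷ w} (hx ∷ h) with x ≟ m
  ... | yes _   = ⊔-lub ≤-refl (mx-replace≤ h)
  ... | no  x≢m = ⊔-lub (<⇒≤ (hx x≢m)) (mx-replace≤ h)

  mx-replace : ∀ {w} → All (λ x → x ≢ m → x < c) w → m ∈ w → mx (map (replace m c) w) ≡ c
  mx-replace {x ∷ w} (hx ∷ h) m∈w with x ≟ m
  mx-replace {x ∷ w} (hx ∷ h) m∈w       | yes _   = m≥n⇒m⊔n≡m (mx-replace≤ h)
  mx-replace {x ∷ w} (hx ∷ h) (here x≡m) | no x≢m = ⊥-elim (x≢m (sym x≡m))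
  mx-replace {x ∷ w} (hx ∷ h) (there m∈w) | no x≢m =
    trans (cong (x ⊔_) (mx-replace h m∈w)) (m≤n⇒m⊔n≡n (<⇒≤ (hx x≢m)))

module _ (v w : Word) where
  private
    m = mx w
    c = suc (mx (v ⊙ dec' w))
    A = shift (mx (dec' w)) v

    A<c : mx A < c
    A<c = s≤s (subst (mx A ≤_) (sym (mx-++ A (dec' w))) (m≤m⊔n (mx A) _))

    bound : All (λ x → x ≢ m → x < c) w
    bound = mx-erase<⇒bounded m c w (s≤s (subst (mx (dec' w) ≤_) (sym (mx-++ A (dec' w))) (m≤n⊔m (mx A) _)))

  ◁R-replace : v ◁R w ≡ A ++ map (replace m c) w
  ◁R-replace = begin
    phi c (replicate (length v) false ++ decI w) (A ++ dec' w)
      ≡⟨ cong (λ n → phi c (replicate n false ++ decI w) (A ++ dec' w)) (sym (length-map (mx (dec' w) +_) v)) ⟩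
    phi c (replicate (length A) false ++ decI w) (A ++ dec' w)
      ≡⟨ phi-replicate-false-++ c A (decI w) (dec' w) ⟩
    A ++ phi c (decI w) (dec' w)
      ≡⟨ cong (A ++_) (phi-marks-erase c m w) ⟩
    A ++ map (replace m c) w ∎

  mx-◁R : m ∈ w → mx (v ◁R w) ≡ c
  mx-◁R m∈w = begin
    mx (v ◁R w)                          ≡⟨ cong mx ◁R-replace ⟩
    mx (A ++ map (replace m c) w)        ≡⟨ mx-++ A _ ⟩
    mx A ⊔ mx (map (replace m c) w)      ≡⟨ cong (mx A ⊔_) (mx-replace m c bound m∈w) ⟩
    mx A ⊔ c                             ≡⟨ m≤n⇒m⊔n≡n (<⇒≤ A<c) ⟩
    c                                    ∎

  decI-◁R : m ∈ w → decI (v ◁R w) ≡ replicate (length v) false ++ decI w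
  decI-◁R m∈w = begin
    marks (mx (v ◁R w)) (v ◁R w)               ≡⟨ cong₂ marks (mx-◁R m∈w) ◁R-replace ⟩
    marks c (A ++ map (replace m c) w)         ≡⟨ map-++ _ A _ ⟩
    marks c A ++ marks c (map (replace m c) w) ≡⟨ cong₂ _++_ (marks-mx< c A A<c) (marks-replace m c bound) ⟩
    replicate (length A) false ++ decI w       ≡⟨ cong (λ n → replicate n false ++ decI w) (length-map _ v) ⟩
    replicate (length v) false ++ decI w       ∎

  dec'-◁R : m ∈ w → dec' (v ◁R w) ≡ v ⊙ dec' w
  dec'-◁R m∈w = begin
    erase (mx (v ◁R w)) (v ◁R w)               ≡⟨ cong₂ erase (mx-◁R m∈w) ◁R-replace ⟩
    erase c (A ++ map (replace m c) w)         ≡⟨ filter-++ _ A _ ⟩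
    erase c A ++ erase c (map (replace m c) w) ≡⟨ cong₂ _++_ (erase-mx< c A A<c) (erase-replace m c bound) ⟩
    A ++ dec' w                                ∎

mainTheorem15 : (u v w : Word) → Packed u → Packed v → Packed w → w ≢ []
    → u ◁R (v ◁R w) ≡ (u ⊙ v) ◁R w
mainTheorem15 u v w _ _ _ w≢[] = begin
  u ◁R (v ◁R w)
    ≡⟨ cong₂ (λ D J → phi (suc (mx (u ⊙ D))) (replicate (length u) false ++ J) (u ⊙ D))
             (dec'-◁R v w (mx∈ w≢[])) (decI-◁R v w (mx∈ w≢[])) ⟩
  phi (suc (mx (u ⊙ (v ⊙ dec' w)))) (replicate (length u) false ++ (replicate (length v) false ++ decI w))
      (u ⊙ (v ⊙ dec' w))
    ≡⟨ cong₂ (λ D J → phi (suc (mx D)) J D) (⊙-assoc u v (dec' w)) shifted-positions ⟩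
  (u ⊙ v) ◁R w ∎
  where
  shifted-positions : replicate (length u) false ++ (replicate (length v) false ++ decI w)
                    ≡ replicate (length (u ⊙ v)) false ++ decI w
  shifted-positions = begin
    replicate (length u) false ++ (replicate (length v) false ++ decI w)
      ≡⟨ sym (++-assoc (replicate (length u) false) _ _) ⟩
    (replicate (length u) false ++ replicate (length v) false) ++ decI w
      ≡⟨ cong (_++ decI w) (sym (replicate-+ (length u) (length v) false)) ⟩
    replicate (length u + length v) false ++ decI w
      ≡⟨ cong (λ n → replicate n false ++ decI w) (sym (length-⊙ u v)) ⟩
    replicate (length (u ⊙ v)) false ++ decI w ∎
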